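{- Let $A=(\mathbf a_1,\ldots,\mathbf a_n)\in\mathbb Z^{d\times n}$ be a unimodular configuration with no repeated columns, set $A_0=(A,\mathbf 0)$ and $\mathcal P_{A_0}=\mathrm{conv}(\{\mathbf a_1,\dots,\mathbf a_n,\mathbf 0\})$, and assume $\mathcal P_{A_0}\cap\mathbb Z^d=\{\mathbf a_1,\ldots,\mathbf a_n,\mathbf 0\}$. Let $K$ be a field. Let $I_{A^\pm}\subset K[x_1,\dots,x_n,y_1,\dots,y_n,z]$ be the kernel of the map $x_i\mapsto\mathbf t^{\mathbf a_i}s$, $y_i\mapsto\mathbf t^{ -\mathbf a_i}s$, $z\mapsto s$ into $K[t_1^{\pm1},\dots,t_d^{\pm1},s]$, let $<$ be the reverse lexicographic order induced by $z<x_1<y_1<\cdots<x_n<y_n$, and write the reduced Gröbner basis of $I_{A^\pm}$ with respect to $<$ as $\{x_iy_i-z^2:i\in[n]\}\cup\{g_1,\dots,g_s\}$ with $g_1,\dots,g_s\in K[x_1,\dots,x_n,y_1,\dots,y_n]$. Let $I\subset K[x_0,x_1,\dots,x_n,y_0,y_1,\dots,y_n]$ be the toric ideal of $\mathcal P_{A_0}*(-\mathcal P_{A_0})$, i.e. the kernel of $\varphi_*$ into $K[t_0^{\pm1},t_1^{\pm1},\dots,t_d^{\pm1},s]$ with $\varphi_*(x_i)=t_0\mathbf t^{\mathbf a_i}s$, $\varphi_*(y_i)=\mathbf t^{ -\mathbf a_i}s$ for $1\le i\le n$, $\varphi_*(x_0)=t_0s$, $\varphi_*(y_0)=s$. Let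 $<'$ be the reverse lexicographic order induced by $x_0<'y_0<'x_1<'y_1<'\cdots<'x_n<'y_n$. Then the reduced Gröbner basis of $I$ with respect to $<'$ is \[\{x_iy_i-x_0y_0:i\in[n]\}\cup\{g_1,\dots,g_s\}.\]
   Context: A configuration is a matrix whose columns lie on an affine hyperplane not through the origin; an integer matrix of rank $d$ is unimodular if all its nonzero maximal minors have the same absolute value. $\mathbf t^\alpha=t_1^{\alpha_1}\cdots t_d^{\alpha_d}$, $[n]=\{1,\dots,n\}$. The Cayley sum is $\mathcal P_1*\mathcal P_2=\mathrm{conv}(\{1\}\times\mathcal P_1\cup\{0\}\times\mathcal P_2)$ and $-\mathcal P=\{ -\mathbf a:\mathbf a\in\mathcal P\}$. -}

module Defs where

open import Level using (Level; _⊔_) renaming (suc to lsuc)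
open import Algebra.Bundles using (CommutativeRing)
open import Data.Nat as ℕ using (ℕ; zero; suc; _≤_; _<_)
open import Data.Integer as ℤ using (ℤ; +_; ∣_∣)
open import Data.Rational as ℚ using (ℚ)
open import Data.Fin as Fin using (Fin; toℕ; punchIn)
open import Data.Vec as Vec using (Vec; []; _∷_; lookup; replicate; zipWith; _[_]≔_)
open import Data.Vec.Properties using (≡-dec)
open import Data.List as List using (List; allFin; foldr)
open import Data.List.Membership.Propositional using (_∈_)
open import Data.Product using (_×_; _,_; ∃; ∃-syntax; Σ)
open import Data.Sum using (_⊎_)
open import Data.Empty using (⊥)
open import Relation.Nullary using (¬_; yes; no)
open import Relation.Binary.PropositionalEquality using (_≡_)
open import Function using (Injective)

record Field (c ℓ : Level) : Set (lsuc (c ⊔ ℓ)) where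
  field
    commutativeRing : CommutativeRing c ℓ
  open CommutativeRing commutativeRing public
  field
    0≉1 : ¬ (0# ≈ 1#)
    inverse : ∀ x → ¬ (x ≈ 0#) → ∃[ y ] (x * y ≈ 1#)

sumℤ : ∀ {k} → (Fin k → ℤ) → ℤ
sumℤ f = foldr ℤ._+_ (+ 0) (List.map f (allFin _))

det : ∀ k → (Fin k → Fin k → ℤ) → ℤ
det zero M = + 1
det (suc k) M =
  sumℤ (λ j → ((ℤ.- (+ 1)) ℤ.^ toℕ j) ℤ.* (M Fin.zero j ℤ.*
         det k (λ r c → M (Fin.suc r) (punchIn j c))))

-- A d×n integer matrix is given by its list of n columns in ℤ^d.
Matrix : ℕ → ℕ → Set
Matrix d n = Vec (Vec ℤ d) n

StrictlyIncreasing : ∀ {d n} → (Fin d → Fin n) → Set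
StrictlyIncreasing σ = ∀ i j → i Fin.< j → σ i Fin.< σ j

minor : ∀ {d n} → Matrix d n → (Fin d → Fin n) → ℤ
minor {d} A σ = det d (λ r c → lookup (lookup A (σ c)) r)

HasRank : ∀ {n} d → Matrix d n → Set
HasRank {n} d A = ∃[ σ ] (StrictlyIncreasing {d} {n} σ × ¬ (minor A σ ≡ + 0))

Unimodular : ∀ {d n} → Matrix d n → Set
Unimodular {d} {n} A =
  HasRank d A ×
  (∀ (σ τ : Fin d → Fin n) → StrictlyIncreasing σ → StrictlyIncreasing τ →
     ¬ (minor A σ ≡ + 0) → ¬ (minor A τ ≡ + 0) → ∣ minor A σ ∣ ≡ ∣ minor A τ ∣)

dotℤ : ∀ {d} → Vec ℤ d → Vec ℤ d → ℤ
dotℤ u v = Vec.foldr _ ℤ._+_ (+ 0) (zipWith ℤ._*_ u v)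

IsConfiguration : ∀ {d n} → Matrix d n → Set
IsConfiguration {d} {n} A =
  ∃[ h ] ∃[ c ] (¬ (c ≡ + 0) × (∀ i → dotℤ {d} h (lookup A i) ≡ c))

NoRepeatedColumns : ∀ {d n} → Matrix d n → Set
NoRepeatedColumns A = Injective _≡_ _≡_ (lookup A)

sumℚ : ∀ {k} → (Fin k → ℚ) → ℚ
sumℚ f = foldr ℚ._+_ ℚ.0ℚ (List.map f (allFin _))

-- p ∈ conv(a₁,…,aₙ,0): weights λᵢ ≥ 0 (on aᵢ) and μ ≥ 0 (on 0) summing
-- to 1 with p = Σ λᵢ aᵢ + μ·0.
InConvA₀ : ∀ {d n} → Matrix d n → Vec ℤ d → Set
InConvA₀ {d} {n} A p =
  ∃[ λw ] ∃[ μ ]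
    ((∀ i → ℚ.0ℚ ℚ.≤ λw i) × ℚ.0ℚ ℚ.≤ μ ×
     (μ ℚ.+ sumℚ {n} λw ≡ ℚ.1ℚ) ×
     (∀ (r : Fin d) → ℚ._/_ (lookup p r) 1 ≡
        sumℚ (λ i → λw i ℚ.* ℚ._/_ (lookup (lookup A i) r) 1)))

LatticePointsA₀ : ∀ {d n} → Matrix d n → Set
LatticePointsA₀ {d} A =
  ∀ (p : Vec ℤ d) → InConvA₀ A p → p ≡ replicate d (+ 0) ⊎ ∃[ i ] (p ≡ lookup A i)

-- Monomials: exponent vectors Vec ℕ N, where variable index 0 is the
-- SMALLEST variable of the given variable order.

Mon : ℕ → Set
Mon N = Vec ℕ N

deg : ∀ {N} → Mon N → ℕ
deg = Vec.foldr _ ℕ._+_ 0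

RevFirst : ∀ {N} → Mon N → Mon N → Set
RevFirst [] [] = ⊥
RevFirst (a ∷ u) (b ∷ v) = b < a ⊎ (a ≡ b × RevFirst u v)

_<rl_ : ∀ {N} → Mon N → Mon N → Set
u <rl v = deg u < deg v ⊎ (deg u ≡ deg v × RevFirst u v)

_∣ₘ_ : ∀ {N} → Mon N → Mon N → Set
u ∣ₘ v = ∀ i → lookup u i ≤ lookup v i

double : ℕ → ℕ
double zero = zero
double (suc n) = suc (suc (double n))

pairUp : ∀ {n} → Vec (ℕ × ℕ) n → Vec ℕ (double n)
pairUp [] = []
pairUp ((x , y) ∷ ps) = x ∷ y ∷ pairUp ps

unpair : ∀ n → Vec ℕ (double n) → Vec (ℕ × ℕ) n
unpair zero [] = []
unpair (suc n) (x ∷ y ∷ v) = (x , y) ∷ unpair n v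

unitPair : ∀ {n} → Fin n → Vec (ℕ × ℕ) n
unitPair {n} i = replicate n (0 , 0) [ i ]≔ (1 , 1)

zeroPairs : ∀ n → Vec (ℕ × ℕ) n
zeroPairs n = replicate n (0 , 0)

tExp : ∀ {d n} → Matrix d n → Vec (ℕ × ℕ) n → Vec ℤ d
tExp {d} [] [] = replicate d (+ 0)
tExp (a ∷ A) ((x , y) ∷ ps) =
  zipWith ℤ._+_ (Vec.map ((+ x ℤ.- + y) ℤ.*_) a) (tExp A ps)

totDeg : ∀ {n} → Vec (ℕ × ℕ) n → ℕ
totDeg [] = 0
totDeg ((x , y) ∷ ps) = x ℕ.+ y ℕ.+ totDeg ps

sumX : ∀ {n} → Vec (ℕ × ℕ) n → ℕ
sumX [] = 0
sumX ((x , y) ∷ ps) = x ℕ.+ sumX ps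

-- Ring K[z, x₁, y₁, …, xₙ, yₙ] (variables in this order, z smallest).
-- φ± : xᵢ ↦ t^{aᵢ} s, yᵢ ↦ t^{-aᵢ} s, z ↦ s.  Target exponent (s ; t).
φ± : ∀ {d n} → Matrix d n → Mon (suc (double n)) → Vec ℤ (suc d)
φ± {d} {n} A (z ∷ rest) =
  let ps = unpair n rest in + (z ℕ.+ totDeg ps) ∷ tExp A ps

-- Ring K[x₀, y₀, x₁, y₁, …, xₙ, yₙ] (in this order, x₀ smallest).
-- φ* : xᵢ ↦ t₀ t^{aᵢ} s, yᵢ ↦ t^{-aᵢ} s, x₀ ↦ t₀ s, y₀ ↦ s.
-- Target exponent (t₀ ; s ; t).
φ* : ∀ {d n} → Matrix d n → Mon (suc (suc (double n))) → Vec ℤ (suc (suc d))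
φ* {d} {n} A (x₀ ∷ y₀ ∷ rest) =
  let ps = unpair n rest in
  + (x₀ ℕ.+ sumX ps) ∷ + (x₀ ℕ.+ y₀ ℕ.+ totDeg ps) ∷ tExp A ps

module WithField {c ℓ : Level} (K : Field c ℓ) where
  open Field K

  Poly : ℕ → Set c
  Poly N = List (Carrier × Mon N)

  coeff : ∀ {N} → Poly N → Mon N → Carrier
  coeff List.[] m = 0#
  coeff ((a , u) List.∷ p) m with ≡-dec ℕ._≟_ u m
  ... | yes _ = a + coeff p m
  ... | no _ = coeff p m

  _≈ₚ_ : ∀ {N} → Poly N → Poly N → Set ℓ
  p ≈ₚ q = ∀ m → coeff p m ≈ coeff q m

  IsInit : ∀ {N} → (Mon N → Mon N → Set) → Poly N → Mon N → Set ℓ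
  IsInit _<_ f m =
    ¬ (coeff f m ≈ 0#) × (∀ u → ¬ (coeff f u ≈ 0#) → u ≡ m ⊎ u < m)

  imageCoeff : ∀ {N D} → (Mon N → Vec ℤ D) → Poly N → Vec ℤ D → Carrier
  imageCoeff φ List.[] e = 0#
  imageCoeff φ ((a , u) List.∷ p) e with ≡-dec ℤ._≟_ (φ u) e
  ... | yes _ = a + imageCoeff φ p e
  ... | no _ = imageCoeff φ p e

  InKer : ∀ {N D} → (Mon N → Vec ℤ D) → Poly N → Set ℓ
  InKer φ p = ∀ e → imageCoeff φ p e ≈ 0#

  IsGröbnerBasis : ∀ {N} → (Poly N → Set ℓ) → (Mon N → Mon N → Set) →
                   List (Poly N) → Set (c ⊔ ℓ)
  IsGröbnerBasis I _<_ G =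
    (∀ g → g ∈ G → I g) ×
    (∀ f m → I f → IsInit _<_ f m →
       ∃[ g ] ∃[ m′ ] (g ∈ G × IsInit _<_ g m′ × (m′ ∣ₘ m)))

  IsReducedGröbnerBasis : ∀ {N} → (Poly N → Set ℓ) → (Mon N → Mon N → Set) →
                          List (Poly N) → Set (c ⊔ ℓ)
  IsReducedGröbnerBasis I _<_ G =
    IsGröbnerBasis I _<_ G ×
    (∀ g → g ∈ G →
       (∃[ m ] (IsInit _<_ g m × coeff g m ≈ 1#)) ×
       (∀ g′ m′ u → g′ ∈ G → ¬ (g′ ≈ₚ g) → IsInit _<_ g′ m′ →
          ¬ (coeff g u ≈ 0#) → ¬ (m′ ∣ₘ u)))

  bin± : ∀ {n} → Fin n → Poly (suc (double n))
  bin± {n} i = (1# , 0 ∷ pairUp (unitPair i)) List.∷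
               (- 1# , 2 ∷ pairUp (zeroPairs n)) List.∷ List.[]

  bin* : ∀ {n} → Fin n → Poly (suc (suc (double n)))
  bin* {n} i = (1# , 0 ∷ 0 ∷ pairUp (unitPair i)) List.∷
               (- 1# , 1 ∷ 1 ∷ pairUp (zeroPairs n)) List.∷ List.[]

  emb± : ∀ {n} → Poly (double n) → Poly (suc (double n))
  emb± = List.map (λ { (a , u) → (a , 0 ∷ u) })

  emb* : ∀ {n} → Poly (double n) → Poly (suc (suc (double n)))
  emb* = List.map (λ { (a , u) → (a , 0 ∷ 0 ∷ u) })

module Submission where

-- Both bases come from one list G in K[w, x, y]: substitute w ↦ z² for I_{A±} and w ↦ x₀y₀ for I.
-- The two substitutions induce the same monomial order on K[w, x, y] and, because A is a
-- configuration, the same fibres of the monomial maps φ± and φ*; so membership in the ideal,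
-- monicity and interreducedness carry over. For the initial ideal take f ∈ I with initial
-- monomial x₀^a y₀^b m. On the φ*-fibre of that monomial a − b is constant, hence x₀, y₀ ↦ z is
-- injective and order preserving there, and it sends the fibre part of f to an element of I_{A±}
-- with initial monomial z^{a+b} m. Some in(g) divides it, and since no initial monomial of G
-- involves w, the matching initial monomial of the x₀y₀-substitution of g divides x₀^a y₀^b m.

open import Defs
open import Level using (Level; _⊔_)
open import Data.Nat as ℕ using (ℕ; zero; suc; _<_; _≤_)
import Data.Nat.Properties as ℕ
import Data.Nat.Tactic.RingSolver as ℕ-Solver
open import Data.Integer as ℤ using (ℤ)
import Data.Integer.Properties as ℤ
import Data.Integer.Tactic.RingSolver as ℤ-Solver
open import Data.Fin as Fin using (Fin)
open import Data.Vec as Vec using (Vec; []; _∷_)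
open import Data.Vec.Properties using (≡-dec; ∷-injectiveˡ; ∷-injectiveʳ)
open import Data.List as List using (List; []; _∷_; _++_; map; allFin)
import Data.List.Properties as List
open import Data.List.Membership.Propositional using (_∈_)
open import Data.List.Membership.Propositional.Properties using (∈-map⁺; ∈-map⁻; ∈-++⁻)
open import Data.List.Relation.Unary.Any as Any using (Any; here; there; any?; satisfied)
open import Data.List.Relation.Unary.All as All using (All; []; _∷_)
import Data.List.Relation.Unary.All.Properties as All
open import Data.Product as Prod using (_×_; _,_; ∃-syntax; proj₁; proj₂)
open import Data.Sum as Sum using (_⊎_; inj₁; inj₂)
open import Data.Empty using (⊥-elim)
open import Data.Unit using (⊤)
open import Function using (_∘_; _⇔_; mk⇔; Injective)
open import Function.Bundles using (module Equivalence)
open import Relation.Nullary using (¬_; yes; no)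
open import Relation.Binary.PropositionalEquality

RevFirst-asym : ∀ {N} (u v : Mon N) → RevFirst u v → ¬ RevFirst v u
RevFirst-asym [] [] ()
RevFirst-asym (a ∷ u) (b ∷ v) (inj₁ b<a) (inj₁ a<b) = ℕ.<-asym b<a a<b
RevFirst-asym (a ∷ u) (b ∷ v) (inj₁ b<a) (inj₂ (refl , _)) = ℕ.<-irrefl refl b<a
RevFirst-asym (a ∷ u) (b ∷ v) (inj₂ (refl , _)) (inj₁ a<b) = ℕ.<-irrefl refl a<b
RevFirst-asym (a ∷ u) (b ∷ v) (inj₂ (_ , u<v)) (inj₂ (_ , v<u)) = RevFirst-asym u v u<v v<u

<rl-asym : ∀ {N} (u v : Mon N) → u <rl v → ¬ v <rl u
<rl-asym u v (inj₁ lt) (inj₁ gt) = ℕ.<-asym lt gt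
<rl-asym u v (inj₁ lt) (inj₂ (eq , _)) = ℕ.<-irrefl (sym eq) lt
<rl-asym u v (inj₂ (eq , _)) (inj₁ gt) = ℕ.<-irrefl (sym eq) gt
<rl-asym u v (inj₂ (_ , lt)) (inj₂ (_ , gt)) = RevFirst-asym u v lt gt

module Polynomials {c ℓ : Level} (K : Field c ℓ) where
  open Field K using (_≈_; _+_; 0#) renaming (refl to ≈-refl; reflexive to ≈-reflexive)
  open WithField K

  infix 4 _∈ₘ_

  _∈ₘ_ : ∀ {N} → Mon N → Poly N → Set c
  v ∈ₘ p = Any (λ t → proj₂ t ≡ v) p

  rename : ∀ {N N′} → (Mon N → Mon N′) → Poly N → Poly N′
  rename h = map (Prod.map₂ h)

  fibre : ∀ {N D} → (Mon N → Vec ℤ D) → Vec ℤ D → Poly N → Poly N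
  fibre φ e = List.filter (λ t → ≡-dec ℤ._≟_ (φ (proj₂ t)) e)

  coeff≉0⇒∈ₘ : ∀ {N} (p : Poly N) {v} → ¬ coeff p v ≈ 0# → v ∈ₘ p
  coeff≉0⇒∈ₘ [] nz = ⊥-elim (nz ≈-refl)
  coeff≉0⇒∈ₘ ((a , u) ∷ p) {v} nz with ≡-dec ℕ._≟_ u v
  ... | yes u≡v = here u≡v
  ... | no _ = there (coeff≉0⇒∈ₘ p nz)

  All-∈ₘ : ∀ {N} {P : Mon N → Set} {p v} → All (P ∘ proj₂) p → v ∈ₘ p → P v
  All-∈ₘ {P = P} ps v∈p = let Pt , t≡v = All.lookupAny ps v∈p in subst P t≡v Pt

  coeff-head : ∀ {N} a (u : Mon N) p → coeff ((a , u) ∷ p) u ≡ a + coeff p u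
  coeff-head a u p with ≡-dec ℕ._≟_ u u
  ... | yes _ = refl
  ... | no u≢u = ⊥-elim (u≢u refl)

  coeff-miss : ∀ {N} (p : Poly N) {v} → All (λ t → proj₂ t ≢ v) p → coeff p v ≡ 0#
  coeff-miss [] [] = refl
  coeff-miss ((a , u) ∷ p) {v} (u≢v ∷ miss) with ≡-dec ℕ._≟_ u v
  ... | yes u≡v = ⊥-elim (u≢v u≡v)
  ... | no _ = coeff-miss p miss

  ∈ₘ-rename⁻ : ∀ {N N′} (h : Mon N → Mon N′) p {v} → v ∈ₘ rename h p → ∃[ u ] (u ∈ₘ p × h u ≡ v)
  ∈ₘ-rename⁻ h (_ ∷ p) (here hu≡v) = _ , here refl , hu≡v
  ∈ₘ-rename⁻ h (_ ∷ p) (there v∈p) =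
    let u , u∈p , hu≡v = ∈ₘ-rename⁻ h p v∈p in u , there u∈p , hu≡v

  coeff-rename : ∀ {N N′} (h : Mon N → Mon N′) p {v} →
    All (λ t → h (proj₂ t) ≡ h v → proj₂ t ≡ v) p → coeff (rename h p) (h v) ≡ coeff p v
  coeff-rename h [] [] = refl
  coeff-rename h ((a , u) ∷ p) {v} (inj ∷ injs) with ≡-dec ℕ._≟_ (h u) (h v) | ≡-dec ℕ._≟_ u v
  ... | yes _ | yes _ = cong (a +_) (coeff-rename h p injs)
  ... | yes hu≡hv | no u≢v = ⊥-elim (u≢v (inj hu≡hv))
  ... | no hu≢hv | yes u≡v = ⊥-elim (hu≢hv (cong h u≡v))
  ... | no _ | no _ = coeff-rename h p injs

  coeff-rename-injective : ∀ {N N′} {h : Mon N → Mon N′} → Injective _≡_ _≡_ h →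
    ∀ p {v} → coeff (rename h p) (h v) ≡ coeff p v
  coeff-rename-injective {h = h} inj p = coeff-rename h p (All.universal (λ _ → inj) p)

  rename-≈ₚ⁻ : ∀ {N N′} {h : Mon N → Mon N′} → Injective _≡_ _≡_ h →
    ∀ p q → rename h p ≈ₚ rename h q → p ≈ₚ q
  rename-≈ₚ⁻ inj p q hp≈hq v =
    subst₂ _≈_ (coeff-rename-injective inj p) (coeff-rename-injective inj q) (hp≈hq _)

  rename-≈ₚ : ∀ {N N′} {h : Mon N → Mon N′} → Injective _≡_ _≡_ h →
    ∀ p q → p ≈ₚ q → rename h p ≈ₚ rename h q
  rename-≈ₚ {h = h} inj p q p≈q u
    with any? (λ t → ≡-dec ℕ._≟_ (h (proj₂ t)) u) (p ++ q)
  ... | yes hit with satisfied hit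
  ...   | (_ , v) , refl =
    subst₂ _≈_ (sym (coeff-rename-injective inj p)) (sym (coeff-rename-injective inj q)) (p≈q v)
  rename-≈ₚ {h = h} inj p q p≈q u | no none =
    let missp , missq = All.++⁻ p (All.¬Any⇒All¬ (p ++ q) none) in
    subst₂ _≈_ (sym (coeff-miss (rename h p) (All.map⁺ missp)))
               (sym (coeff-miss (rename h q) (All.map⁺ missq))) ≈-refl

  imageCoeff-rename : ∀ {N N′ D} (φ : Mon N′ → Vec ℤ D) (h : Mon N → Mon N′) p e →
    imageCoeff φ (rename h p) e ≡ imageCoeff (φ ∘ h) p e
  imageCoeff-rename φ h [] e = refl
  imageCoeff-rename φ h ((a , u) ∷ p) e with ≡-dec ℤ._≟_ (φ (h u)) e
  ... | yes _ = cong (a +_) (imageCoeff-rename φ h p e)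
  ... | no _ = imageCoeff-rename φ h p e

  InKer-rename⁺ : ∀ {N N′ D} (φ : Mon N′ → Vec ℤ D) (h : Mon N → Mon N′) p →
    InKer (φ ∘ h) p → InKer φ (rename h p)
  InKer-rename⁺ φ h p p∈ker e = subst (_≈ 0#) (sym (imageCoeff-rename φ h p e)) (p∈ker e)

  InKer-rename⁻ : ∀ {N N′ D} (φ : Mon N′ → Vec ℤ D) (h : Mon N → Mon N′) p →
    InKer φ (rename h p) → InKer (φ ∘ h) p
  InKer-rename⁻ φ h p hp∈ker e = subst (_≈ 0#) (imageCoeff-rename φ h p e) (hp∈ker e)

  imageCoeff-miss : ∀ {N D} (φ : Mon N → Vec ℤ D) p {e} →
    All (λ t → φ (proj₂ t) ≢ e) p → imageCoeff φ p e ≡ 0#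
  imageCoeff-miss φ [] [] = refl
  imageCoeff-miss φ ((a , u) ∷ p) {e} (φu≢e ∷ miss) with ≡-dec ℤ._≟_ (φ u) e
  ... | yes φu≡e = ⊥-elim (φu≢e φu≡e)
  ... | no _ = imageCoeff-miss φ p miss

  imageCoeff-cong : ∀ {N D D′} (φ : Mon N → Vec ℤ D) (φ′ : Mon N → Vec ℤ D′) p {e e′} →
    All (λ t → (φ (proj₂ t) ≡ e) ⇔ (φ′ (proj₂ t) ≡ e′)) p →
    imageCoeff φ p e ≡ imageCoeff φ′ p e′
  imageCoeff-cong φ φ′ [] [] = refl
  imageCoeff-cong φ φ′ ((a , u) ∷ p) {e} {e′} (hit⇔hit′ ∷ rest)
    with ≡-dec ℤ._≟_ (φ u) e | ≡-dec ℤ._≟_ (φ′ u) e′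
  ... | yes _ | yes _ = cong (a +_) (imageCoeff-cong φ φ′ p rest)
  ... | yes hit | no miss′ = ⊥-elim (miss′ (Equivalence.to hit⇔hit′ hit))
  ... | no miss | yes hit′ = ⊥-elim (miss (Equivalence.from hit⇔hit′ hit′))
  ... | no _ | no _ = imageCoeff-cong φ φ′ p rest

  InKer-fibrewise : ∀ {N D D′} {φ : Mon N → Vec ℤ D} {φ′ : Mon N → Vec ℤ D′}
    (S : Mon N → Set) → (∀ {u v} → S u → S v → (φ u ≡ φ v) ⇔ (φ′ u ≡ φ′ v)) →
    ∀ p → All (S ∘ proj₂) p → InKer φ p → InKer φ′ p
  InKer-fibrewise {φ = φ} {φ′} S sameFibres p Sp p∈ker e′
    with any? (λ t → ≡-dec ℤ._≟_ (φ′ (proj₂ t)) e′) p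
  ... | no none = ≈-reflexive (imageCoeff-miss φ′ p (All.¬Any⇒All¬ p none))
  ... | yes hit = subst (_≈ 0#) (imageCoeff-cong φ φ′ p (All.map sameFibreAsHit Sp)) (p∈ker (φ t))
    where
    t = proj₂ (Any.lookup hit)
    St&φ′t≡e′ = All.lookupAny Sp hit
    sameFibreAsHit : ∀ {s} → S s → (φ s ≡ φ t) ⇔ (φ′ s ≡ e′)
    sameFibreAsHit Ss = let open Equivalence (sameFibres Ss (proj₁ St&φ′t≡e′)) in
      mk⇔ (λ eq → trans (to eq) (proj₂ St&φ′t≡e′)) (λ eq → from (trans eq (sym (proj₂ St&φ′t≡e′))))

  All-fibre : ∀ {N D} (φ : Mon N → Vec ℤ D) e p → All (λ t → φ (proj₂ t) ≡ e) (fibre φ e p)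
  All-fibre φ e = All.all-filter _

  coeff-fibre : ∀ {N D} (φ : Mon N → Vec ℤ D) {e} p {v} → φ v ≡ e →
    coeff (fibre φ e p) v ≡ coeff p v
  coeff-fibre φ [] φv≡e = refl
  coeff-fibre φ {e} ((a , u) ∷ p) {v} φv≡e with ≡-dec ℤ._≟_ (φ u) e
  ... | yes _ with ≡-dec ℕ._≟_ u v
  ...   | yes _ = cong (a +_) (coeff-fibre φ p φv≡e)
  ...   | no _ = coeff-fibre φ p φv≡e
  coeff-fibre φ {e} ((a , u) ∷ p) {v} φv≡e | no φu≢e with ≡-dec ℕ._≟_ u v
  ...   | yes refl = ⊥-elim (φu≢e φv≡e)
  ...   | no _ = coeff-fibre φ p φv≡e

  imageCoeff-fibre : ∀ {N D} (φ : Mon N → Vec ℤ D) e p →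
    imageCoeff φ (fibre φ e p) e ≡ imageCoeff φ p e
  imageCoeff-fibre φ e [] = refl
  imageCoeff-fibre φ e ((a , u) ∷ p) with ≡-dec ℤ._≟_ (φ u) e
  ... | no _ = imageCoeff-fibre φ e p
  ... | yes φu≡e with ≡-dec ℤ._≟_ (φ u) e
  ...   | yes _ = cong (a +_) (imageCoeff-fibre φ e p)
  ...   | no φu≢e = ⊥-elim (φu≢e φu≡e)

  InKer-fibre : ∀ {N D} (φ : Mon N → Vec ℤ D) e p → InKer φ p → InKer φ (fibre φ e p)
  InKer-fibre φ e p p∈ker e′ with ≡-dec ℤ._≟_ e e′
  ... | yes refl = subst (_≈ 0#) (sym (imageCoeff-fibre φ e p)) (p∈ker e)
  ... | no e≢e′ = ≈-reflexive (imageCoeff-miss φ (fibre φ e p)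
                    (All.map (λ φt≡e φt≡e′ → e≢e′ (trans (sym φt≡e) φt≡e′)) (All-fibre φ e p)))

  IsInit-fibre : ∀ {N D} (_<_ : Mon N → Mon N → Set) (φ : Mon N → Vec ℤ D) f {m} →
    IsInit _<_ f m → IsInit _<_ (fibre φ (φ m) f) m
  IsInit-fibre _<_ φ f {m} (nz , max) = nz ∘ subst (_≈ 0#) (coeff-fibre φ f refl) , max′
    where
    max′ : ∀ u → ¬ coeff (fibre φ (φ m) f) u ≈ 0# → u ≡ m ⊎ u < m
    max′ u nzu = max u (nzu ∘ subst (_≈ 0#) (sym (coeff-fibre φ f φu≡φm)))
      where φu≡φm = All-∈ₘ (All-fibre φ (φ m) f) (coeff≉0⇒∈ₘ _ nzu)

  module _ {N N′} (_<_ : Mon N → Mon N → Set) (_<′_ : Mon N′ → Mon N′ → Set) where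

    IsInit-rename : {h : Mon N → Mon N′} (S : Mon N → Set) →
      (∀ {u v} → S u → S v → h u ≡ h v → u ≡ v) →
      (∀ {u v} → S u → S v → u < v → h u <′ h v) →
      ∀ p {m} → All (S ∘ proj₂) p → IsInit _<_ p m → IsInit _<′_ (rename h p) (h m)
    IsInit-rename {h} S inj mono p {m} Sp (nz , max) = nz ∘ subst (_≈ 0#) (coeff-h Sm) , max′
      where
      Sm : S m
      Sm = All-∈ₘ Sp (coeff≉0⇒∈ₘ p nz)
      coeff-h : ∀ {v} → S v → coeff (rename h p) (h v) ≡ coeff p v
      coeff-h Sv = coeff-rename h p (All.map (λ St → inj St Sv) Sp)
      max′ : ∀ u → ¬ coeff (rename h p) u ≈ 0# → u ≡ h m ⊎ u <′ h m
      max′ u nzu with ∈ₘ-rename⁻ h p (coeff≉0⇒∈ₘ _ nzu)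
      ... | v , v∈p , refl =
        let Sv = All-∈ₘ Sp v∈p in
        Sum.map (cong h) (mono Sv Sm) (max v (nzu ∘ subst (_≈ 0#) (sym (coeff-h Sv))))

    IsInit-rename-injective : {h : Mon N → Mon N′} → Injective _≡_ _≡_ h →
      (∀ {u v} → u < v → h u <′ h v) →
      ∀ p {m} → IsInit _<_ p m → IsInit _<′_ (rename h p) (h m)
    IsInit-rename-injective inj mono p =
      IsInit-rename (λ _ → ⊤) (λ _ _ → inj) (λ _ _ → mono) p (All.universal _ p)

    IsInit-rename⁻ : {h : Mon N → Mon N′} → Injective _≡_ _≡_ h →
      (∀ {u v} → h u <′ h v → u < v) →
      ∀ p {m′} → IsInit _<′_ (rename h p) m′ → ∃[ m ] (h m ≡ m′ × IsInit _<_ p m)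
    IsInit-rename⁻ {h} inj reflect p (nz , max) with ∈ₘ-rename⁻ h p (coeff≉0⇒∈ₘ _ nz)
    ... | m , _ , refl = m , refl , nz ∘ subst (_≈ 0#) (sym (coeff-h m)) , max′
      where
      coeff-h : ∀ v → coeff (rename h p) (h v) ≡ coeff p v
      coeff-h v = coeff-rename-injective inj p
      max′ : ∀ v → ¬ coeff p v ≈ 0# → v ≡ m ⊎ v < m
      max′ v nzv = Sum.map inj reflect (max (h v) (nzv ∘ subst (_≈ 0#) (coeff-h v)))

double-< : ∀ {c c′} → c < c′ → c ℕ.+ c < c′ ℕ.+ c′
double-< c<c′ = ℕ.+-mono-< c<c′ c<c′

double-≤⁻ : ∀ {c c′} → c ℕ.+ c ≤ c′ ℕ.+ c′ → c ≤ c′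
double-≤⁻ 2c≤2c′ = ℕ.≮⇒≥ (λ c′<c → ℕ.<⇒≱ (double-< c′<c) 2c≤2c′)

double-<⁻ : ∀ {c c′} → c ℕ.+ c < c′ ℕ.+ c′ → c < c′
double-<⁻ 2c<2c′ = ℕ.≰⇒> (λ c′≤c → ℕ.<⇒≱ 2c<2c′ (ℕ.+-mono-≤ c′≤c c′≤c))

double-injective : ∀ c c′ → c ℕ.+ c ≡ c′ ℕ.+ c′ → c ≡ c′
double-injective c c′ 2c≡2c′ =
  ℕ.≤-antisym (double-≤⁻ (ℕ.≤-reflexive 2c≡2c′)) (double-≤⁻ (ℕ.≤-reflexive (sym 2c≡2c′)))

-- On exponent vectors whose first entry is the exponent of w (resp. z, resp. x₀ then y₀):
-- δ± is w ↦ z², δ* is w ↦ x₀y₀ and ψ is x₀, y₀ ↦ z.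
module _ {N : ℕ} where

  δ± : Mon (suc N) → Mon (suc N)
  δ± (c ∷ x) = (c ℕ.+ c) ∷ x

  δ* : Mon (suc N) → Mon (suc (suc N))
  δ* (c ∷ x) = c ∷ c ∷ x

  ψ : Mon (suc (suc N)) → Mon (suc N)
  ψ (a ∷ b ∷ x) = (a ℕ.+ b) ∷ x

  infix 4 _<w_

  _<w_ : Mon (suc N) → Mon (suc N) → Set
  u <w v = δ± u <rl δ± v

  δ±-injective : Injective _≡_ _≡_ δ±
  δ±-injective {c ∷ x} {c′ ∷ x′} eq with double-injective c c′ (∷-injectiveˡ eq) | ∷-injectiveʳ eq
  ... | refl | refl = refl

  δ*-injective : Injective _≡_ _≡_ δ*
  δ*-injective {c ∷ x} {c′ ∷ x′} refl = refl

  deg-δ* : ∀ u → deg (δ* u) ≡ deg (δ± u)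
  deg-δ* (c ∷ x) = sym (ℕ.+-assoc c c (deg x))

  δ*-reflects-< : ∀ u v → δ* u <rl δ* v → u <w v
  δ*-reflects-< u v (inj₁ deg<) = inj₁ (subst₂ _<_ (deg-δ* u) (deg-δ* v) deg<)
  δ*-reflects-< (c ∷ x) (c′ ∷ x′) (inj₂ (deg≡ , rev)) = inj₂ (deg≡′ , revFirst rev)
    where
    deg≡′ = trans (sym (deg-δ* (c ∷ x))) (trans deg≡ (deg-δ* (c′ ∷ x′)))
    revFirst : RevFirst (δ* (c ∷ x)) (δ* (c′ ∷ x′)) → RevFirst (δ± (c ∷ x)) (δ± (c′ ∷ x′))
    revFirst (inj₁ c′<c) = inj₁ (double-< c′<c)
    revFirst (inj₂ (refl , inj₁ c<c)) = ⊥-elim (ℕ.<-irrefl refl c<c)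
    revFirst (inj₂ (refl , inj₂ (_ , x<x′))) = inj₂ (refl , x<x′)

  δ*-preserves-< : ∀ u v → u <w v → δ* u <rl δ* v
  δ*-preserves-< u v (inj₁ deg<) = inj₁ (subst₂ _<_ (sym (deg-δ* u)) (sym (deg-δ* v)) deg<)
  δ*-preserves-< (c ∷ x) (c′ ∷ x′) (inj₂ (deg≡ , rev)) = inj₂ (deg≡′ , revFirst rev)
    where
    deg≡′ = trans (deg-δ* (c ∷ x)) (trans deg≡ (sym (deg-δ* (c′ ∷ x′))))
    revFirst : RevFirst (δ± (c ∷ x)) (δ± (c′ ∷ x′)) → RevFirst (δ* (c ∷ x)) (δ* (c′ ∷ x′))
    revFirst (inj₁ 2c′<2c) = inj₁ (double-<⁻ 2c′<2c)
    revFirst (inj₂ (2c≡2c′ , x<x′)) with double-injective c c′ 2c≡2c′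
    ... | refl = inj₂ (refl , inj₂ (refl , x<x′))

δ*-∣ₘ⇒δ±-∣ₘ : ∀ {N} (u v : Mon (suc N)) → δ* u ∣ₘ δ* v → δ± u ∣ₘ δ± v
δ*-∣ₘ⇒δ±-∣ₘ (c ∷ x) (c′ ∷ x′) δ*u∣δ*v Fin.zero = ℕ.+-mono-≤ (δ*u∣δ*v Fin.zero) (δ*u∣δ*v Fin.zero)
δ*-∣ₘ⇒δ±-∣ₘ (c ∷ x) (c′ ∷ x′) δ*u∣δ*v (Fin.suc i) = δ*u∣δ*v (Fin.suc (Fin.suc i))

sumY : ∀ {n} → Vec (ℕ × ℕ) n → ℕ
sumY [] = 0
sumY ((x , y) ∷ ps) = y ℕ.+ sumY ps

totDeg≡sumX+sumY : ∀ {n} (ps : Vec (ℕ × ℕ) n) → totDeg ps ≡ sumX ps ℕ.+ sumY ps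
totDeg≡sumX+sumY [] = refl
totDeg≡sumX+sumY ((x , y) ∷ ps) rewrite totDeg≡sumX+sumY ps = identity x y (sumX ps) (sumY ps)
  where
  identity : ∀ x y X Y → x ℕ.+ y ℕ.+ (X ℕ.+ Y) ≡ x ℕ.+ X ℕ.+ (y ℕ.+ Y)
  identity = ℕ-Solver.solve-∀

deg≡totDeg-unpair : ∀ n (w : Mon (double n)) → deg w ≡ totDeg (unpair n w)
deg≡totDeg-unpair zero [] = refl
deg≡totDeg-unpair (suc n) (x ∷ y ∷ w) rewrite deg≡totDeg-unpair n w = sym (ℕ.+-assoc x y _)

dotℤ-+ʳ : ∀ {d} (h u v : Vec ℤ d) → dotℤ h (Vec.zipWith ℤ._+_ u v) ≡ dotℤ h u ℤ.+ dotℤ h v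
dotℤ-+ʳ [] [] [] = refl
dotℤ-+ʳ (h ∷ hs) (u ∷ us) (v ∷ vs) rewrite dotℤ-+ʳ hs us vs = identity h u v (dotℤ hs us) (dotℤ hs vs)
  where
  identity : ∀ h u v r s → h ℤ.* (u ℤ.+ v) ℤ.+ (r ℤ.+ s) ≡ (h ℤ.* u ℤ.+ r) ℤ.+ (h ℤ.* v ℤ.+ s)
  identity = ℤ-Solver.solve-∀

dotℤ-*ʳ : ∀ {d} (h a : Vec ℤ d) k → dotℤ h (Vec.map (k ℤ.*_) a) ≡ k ℤ.* dotℤ h a
dotℤ-*ʳ [] [] k = sym (ℤ.*-zeroʳ k)
dotℤ-*ʳ (h ∷ hs) (a ∷ as) k rewrite dotℤ-*ʳ hs as k = identity h a k (dotℤ hs as)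
  where
  identity : ∀ h a k r → h ℤ.* (k ℤ.* a) ℤ.+ k ℤ.* r ≡ k ℤ.* (h ℤ.* a ℤ.+ r)
  identity = ℤ-Solver.solve-∀

dotℤ-zeroʳ : ∀ {d} (h : Vec ℤ d) → dotℤ h (Vec.replicate d (ℤ.+ 0)) ≡ ℤ.+ 0
dotℤ-zeroʳ [] = refl
dotℤ-zeroʳ (h ∷ hs) rewrite dotℤ-zeroʳ hs | ℤ.*-zeroʳ h = refl

dotℤ-tExp : ∀ {d n} (A : Matrix d n) h k → (∀ i → dotℤ h (Vec.lookup A i) ≡ k) →
  ∀ ps → dotℤ h (tExp A ps) ≡ k ℤ.* (ℤ.+ sumX ps ℤ.- ℤ.+ sumY ps)
dotℤ-tExp [] h k _ [] = trans (dotℤ-zeroʳ h) (sym (ℤ.*-zeroʳ k))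
dotℤ-tExp (a ∷ A) h k onHyperplane ((x , y) ∷ ps)
  rewrite dotℤ-+ʳ h (Vec.map ((ℤ.+ x ℤ.- ℤ.+ y) ℤ.*_) a) (tExp A ps)
        | dotℤ-*ʳ h a (ℤ.+ x ℤ.- ℤ.+ y) | onHyperplane Fin.zero
        | dotℤ-tExp A h k (onHyperplane ∘ Fin.suc) ps
        | ℤ.pos-+ x (sumX ps) | ℤ.pos-+ y (sumY ps)
  = identity (ℤ.+ x) (ℤ.+ y) k (ℤ.+ sumX ps) (ℤ.+ sumY ps)
  where
  identity : ∀ x y k X Y → (x ℤ.- y) ℤ.* k ℤ.+ k ℤ.* (X ℤ.- Y) ≡ k ℤ.* ((x ℤ.+ X) ℤ.- (y ℤ.+ Y))
  identity = ℤ-Solver.solve-∀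

tExp-≡⇒sumX−sumY-≡ : ∀ {d n} (A : Matrix d n) → IsConfiguration A → ∀ ps ps′ →
  tExp A ps ≡ tExp A ps′ → sumX ps ℕ.+ sumY ps′ ≡ sumX ps′ ℕ.+ sumY ps
tExp-≡⇒sumX−sumY-≡ A (h , k , k≢0 , onHyperplane) ps ps′ tExp≡ = ℤ.+-injective (begin
  ℤ.+ (X ℕ.+ Y′)               ≡⟨ ℤ.pos-+ X Y′ ⟩
  ℤ.+ X ℤ.+ ℤ.+ Y′             ≡⟨ regroup (ℤ.+ X) (ℤ.+ Y) (ℤ.+ Y′) ⟩
  (ℤ.+ X ℤ.- ℤ.+ Y) ℤ.+ (ℤ.+ Y ℤ.+ ℤ.+ Y′)    ≡⟨ cong (ℤ._+ (ℤ.+ Y ℤ.+ ℤ.+ Y′)) X−Y≡X′−Y′ ⟩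
  (ℤ.+ X′ ℤ.- ℤ.+ Y′) ℤ.+ (ℤ.+ Y ℤ.+ ℤ.+ Y′)  ≡⟨ regroup′ (ℤ.+ X′) (ℤ.+ Y) (ℤ.+ Y′) ⟩
  ℤ.+ X′ ℤ.+ ℤ.+ Y             ≡⟨ ℤ.pos-+ X′ Y ⟨
  ℤ.+ (X′ ℕ.+ Y)               ∎)
  where
  open ≡-Reasoning
  X = sumX ps
  Y = sumY ps
  X′ = sumX ps′
  Y′ = sumY ps′
  X−Y≡X′−Y′ : ℤ.+ X ℤ.- ℤ.+ Y ≡ ℤ.+ X′ ℤ.- ℤ.+ Y′
  X−Y≡X′−Y′ = ℤ.*-cancelˡ-≡ k _ _ {{ℤ.≢-nonZero k≢0}}
    (trans (sym (dotℤ-tExp A h k onHyperplane ps))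
      (trans (cong (dotℤ h) tExp≡) (dotℤ-tExp A h k onHyperplane ps′)))
  regroup : ∀ X Y Y′ → X ℤ.+ Y′ ≡ (X ℤ.- Y) ℤ.+ (Y ℤ.+ Y′)
  regroup = ℤ-Solver.solve-∀
  regroup′ : ∀ X′ Y Y′ → (X′ ℤ.- Y′) ℤ.+ (Y ℤ.+ Y′) ≡ X′ ℤ.+ Y
  regroup′ = ℤ-Solver.solve-∀

module ToricFibres {d n : ℕ} (A : Matrix d n) (conf : IsConfiguration A) where

  xdeg ydeg : Mon (double n) → ℕ
  xdeg w = sumX (unpair n w)
  ydeg w = sumY (unpair n w)

  φ±-≡⇒deg-≡ : ∀ s w s′ w′ → φ± A (s ∷ w) ≡ φ± A (s′ ∷ w′) →
    s ℕ.+ (xdeg w ℕ.+ ydeg w) ≡ s′ ℕ.+ (xdeg w′ ℕ.+ ydeg w′)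
  φ±-≡⇒deg-≡ s w s′ w′ eq =
    subst₂ (λ T T′ → s ℕ.+ T ≡ s′ ℕ.+ T′) (totDeg≡sumX+sumY (unpair n w)) (totDeg≡sumX+sumY (unpair n w′))
      (ℤ.+-injective (∷-injectiveˡ eq))

  φ±-≡⇒xdeg−ydeg-≡ : ∀ s w s′ w′ → φ± A (s ∷ w) ≡ φ± A (s′ ∷ w′) →
    xdeg w ℕ.+ ydeg w′ ≡ xdeg w′ ℕ.+ ydeg w
  φ±-≡⇒xdeg−ydeg-≡ s w s′ w′ eq = tExp-≡⇒sumX−sumY-≡ A conf (unpair n w) (unpair n w′) (∷-injectiveʳ eq)

  φ*-≡⇒deg-≡ : ∀ u v → φ* A u ≡ φ* A v → deg u ≡ deg v
  φ*-≡⇒deg-≡ (a ∷ b ∷ w) (a′ ∷ b′ ∷ w′) eq = begin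
    a ℕ.+ (b ℕ.+ deg w)               ≡⟨ ℕ.+-assoc a b (deg w) ⟨
    a ℕ.+ b ℕ.+ deg w                 ≡⟨ cong (a ℕ.+ b ℕ.+_) (deg≡totDeg-unpair n w) ⟩
    a ℕ.+ b ℕ.+ totDeg (unpair n w)   ≡⟨ ℤ.+-injective (∷-injectiveˡ (∷-injectiveʳ eq)) ⟩
    a′ ℕ.+ b′ ℕ.+ totDeg (unpair n w′) ≡⟨ cong (a′ ℕ.+ b′ ℕ.+_) (deg≡totDeg-unpair n w′) ⟨
    a′ ℕ.+ b′ ℕ.+ deg w′              ≡⟨ ℕ.+-assoc a′ b′ (deg w′) ⟩
    a′ ℕ.+ (b′ ℕ.+ deg w′)            ∎
    where open ≡-Reasoning

  -- φ* determines a − b = 2(a + X) − (a + b + X + Y) − (X − Y); below with all subtractions moved across.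
  φ*-≡⇒x₀−y₀-≡ : ∀ a b w a′ b′ w′ → φ* A (a ∷ b ∷ w) ≡ φ* A (a′ ∷ b′ ∷ w′) → a ℕ.+ b′ ≡ a′ ℕ.+ b
  φ*-≡⇒x₀−y₀-≡ a b w a′ b′ w′ eq =
    ℕ.+-cancelʳ-≡ S (a ℕ.+ b′) (a′ ℕ.+ b) (trans (identity a b a′ b′ X Y X′ Y′) (cong (a′ ℕ.+ b ℕ.+_) S′≡S))
    where
    X = xdeg w
    Y = ydeg w
    X′ = xdeg w′
    Y′ = ydeg w′
    φ±ψ-eq = ∷-injectiveʳ eq
    S = (a′ ℕ.+ X′) ℕ.+ (a′ ℕ.+ X′) ℕ.+ (a ℕ.+ b ℕ.+ (X ℕ.+ Y)) ℕ.+ (X ℕ.+ Y′)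
    S′≡S : (a ℕ.+ X) ℕ.+ (a ℕ.+ X) ℕ.+ (a′ ℕ.+ b′ ℕ.+ (X′ ℕ.+ Y′)) ℕ.+ (X′ ℕ.+ Y) ≡ S
    S′≡S = let a+X≡a′+X′ = ℤ.+-injective (∷-injectiveˡ eq) in
      cong₂ ℕ._+_ (cong₂ ℕ._+_ (cong₂ ℕ._+_ a+X≡a′+X′ a+X≡a′+X′)
                               (sym (φ±-≡⇒deg-≡ (a ℕ.+ b) w (a′ ℕ.+ b′) w′ φ±ψ-eq)))
                  (sym (φ±-≡⇒xdeg−ydeg-≡ (a ℕ.+ b) w (a′ ℕ.+ b′) w′ φ±ψ-eq))
    identity : ∀ a b a′ b′ X Y X′ Y′ →
      a ℕ.+ b′ ℕ.+ ((a′ ℕ.+ X′) ℕ.+ (a′ ℕ.+ X′) ℕ.+ (a ℕ.+ b ℕ.+ (X ℕ.+ Y)) ℕ.+ (X ℕ.+ Y′))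
      ≡ a′ ℕ.+ b ℕ.+ ((a ℕ.+ X) ℕ.+ (a ℕ.+ X) ℕ.+ (a′ ℕ.+ b′ ℕ.+ (X′ ℕ.+ Y′)) ℕ.+ (X′ ℕ.+ Y))
    identity = ℕ-Solver.solve-∀

  φ*-≡⇒φ±∘ψ-≡ : ∀ u v → φ* A u ≡ φ* A v → φ± A (ψ u) ≡ φ± A (ψ v)
  φ*-≡⇒φ±∘ψ-≡ (a ∷ b ∷ w) (a′ ∷ b′ ∷ w′) = cong Vec.tail

  ψ-injective-on-fibres : ∀ u v → φ* A u ≡ φ* A v → ψ u ≡ ψ v → u ≡ v
  ψ-injective-on-fibres (a ∷ b ∷ w) (a′ ∷ b′ ∷ w′) φu≡φv ψu≡ψv with ∷-injectiveʳ ψu≡ψv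
  ... | refl with ℕ.+-cancelʳ-≡ (xdeg w) a a′ (ℤ.+-injective (∷-injectiveˡ φu≡φv))
  ... | refl with ℕ.+-cancelˡ-≡ a b b′ (∷-injectiveˡ ψu≡ψv)
  ... | refl = refl

  ψ-monotone-on-fibres : ∀ u v → φ* A u ≡ φ* A v → u <rl v → ψ u <rl ψ v
  ψ-monotone-on-fibres u v φu≡φv (inj₁ deg<) = ⊥-elim (ℕ.<-irrefl (φ*-≡⇒deg-≡ u v φu≡φv) deg<)
  ψ-monotone-on-fibres (a ∷ b ∷ w) (a′ ∷ b′ ∷ w′) φu≡φv (inj₂ (_ , rev)) = inj₂ (deg≡ , revFirst rev)
    where
    a+b′≡a′+b = φ*-≡⇒x₀−y₀-≡ a b w a′ b′ w′ φu≡φv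
    deg≡ = trans (ℕ.+-assoc a b (deg w))
             (trans (φ*-≡⇒deg-≡ (a ∷ b ∷ w) (a′ ∷ b′ ∷ w′) φu≡φv) (sym (ℕ.+-assoc a′ b′ (deg w′))))
    revFirst : RevFirst (a ∷ b ∷ w) (a′ ∷ b′ ∷ w′) → RevFirst ((a ℕ.+ b) ∷ w) ((a′ ℕ.+ b′) ∷ w′)
    revFirst (inj₁ a′<a) = inj₁ (ℕ.+-mono-< a′<a b′<b)
      where
      b′<b : b′ < b
      b′<b = ℕ.≰⇒> (λ b≤b′ → ℕ.<-irrefl (sym a+b′≡a′+b) (ℕ.+-mono-<-≤ a′<a b≤b′))
    revFirst (inj₂ (refl , inj₁ b′<b)) = ⊥-elim (ℕ.<-irrefl (ℕ.+-cancelˡ-≡ a b′ b a+b′≡a′+b) b′<b)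
    revFirst (inj₂ (refl , inj₂ (refl , w<w′))) = inj₂ (refl , w<w′)

  -- φ± ∘ δ± determines 2c + X + Y and X − Y, hence the extra entry c + X of φ* ∘ δ*.
  δ-sameFibres : ∀ u v → (φ± A (δ± u) ≡ φ± A (δ± v)) ⇔ (φ* A (δ* u) ≡ φ* A (δ* v))
  δ-sameFibres (c ∷ x) (c′ ∷ x′) = mk⇔ (λ eq → cong₂ _∷_ (cong ℤ.+_ (c+X≡c′+X′ eq)) eq) (cong Vec.tail)
    where
    X = xdeg x
    Y = ydeg x
    X′ = xdeg x′
    Y′ = ydeg x′
    identity : ∀ c X Y c′ X′ Y′ →
      (c ℕ.+ X) ℕ.+ (c ℕ.+ X) ℕ.+ ((c′ ℕ.+ c′ ℕ.+ (X′ ℕ.+ Y′)) ℕ.+ (X′ ℕ.+ Y))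
      ≡ (c′ ℕ.+ X′) ℕ.+ (c′ ℕ.+ X′) ℕ.+ ((c ℕ.+ c ℕ.+ (X ℕ.+ Y)) ℕ.+ (X ℕ.+ Y′))
    identity = ℕ-Solver.solve-∀
    c+X≡c′+X′ : φ± A (δ± (c ∷ x)) ≡ φ± A (δ± (c′ ∷ x′)) → c ℕ.+ X ≡ c′ ℕ.+ X′
    c+X≡c′+X′ eq = double-injective _ _ (ℕ.+-cancelʳ-≡ _ _ _
      (trans (identity c X Y c′ X′ Y′)
        (cong ((c′ ℕ.+ X′) ℕ.+ (c′ ℕ.+ X′) ℕ.+_)
          (cong₂ ℕ._+_ (φ±-≡⇒deg-≡ (c ℕ.+ c) x (c′ ℕ.+ c′) x′ eq)
                       (φ±-≡⇒xdeg−ydeg-≡ (c ℕ.+ c) x (c′ ℕ.+ c′) x′ eq)))))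

InitialsFreeOfW : ∀ {c ℓ N} (K : Field c ℓ) → List (WithField.Poly K (suc N)) → Set (c ⊔ ℓ)
InitialsFreeOfW K G = ∀ {g} → g ∈ G → ∀ {c x} → IsInit _<w_ g (c ∷ x) → c ≡ 0
  where open WithField K

module GröbnerTransfer {c ℓ : Level} (K : Field c ℓ) {d n : ℕ} (A : Matrix d n) (conf : IsConfiguration A) where
  open Field K using (_≈_; 0#; 1#)
  open WithField K
  open Polynomials K
  open ToricFibres A conf

  IsInit-δ± : ∀ (g : Poly (suc (double n))) {m} → IsInit _<w_ g m → IsInit _<rl_ (rename δ± g) (δ± m)
  IsInit-δ± = IsInit-rename-injective _<w_ _<rl_ δ±-injective (λ u<v → u<v)

  IsInit-δ* : ∀ (g : Poly (suc (double n))) {m} → IsInit _<w_ g m → IsInit _<rl_ (rename δ* g) (δ* m)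
  IsInit-δ* = IsInit-rename-injective _<w_ _<rl_ δ*-injective (δ*-preserves-< _ _)

  InKer-δ±⇒InKer-δ* : ∀ g → InKer (φ± A) (rename δ± g) → InKer (φ* A) (rename δ* g)
  InKer-δ±⇒InKer-δ* g δ±g∈ker =
    InKer-rename⁺ (φ* A) δ* g
      (InKer-fibrewise (λ _ → ⊤) (λ _ _ → δ-sameFibres _ _) g (All.universal _ g)
        (InKer-rename⁻ (φ± A) δ± g δ±g∈ker))

  collapse : Poly (suc (suc (double n))) → Mon (suc (suc (double n))) → Poly (suc (double n))
  collapse f m = rename ψ (fibre (φ* A) (φ* A m) f)

  InKer-collapse : ∀ f m → InKer (φ* A) f → InKer (φ± A) (collapse f m)
  InKer-collapse f m f∈ker =
    InKer-rename⁺ (φ± A) ψ fibreOfm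
      (InKer-fibrewise (λ u → φ* A u ≡ φ* A m)
        (λ {u} {v} Su Sv → mk⇔ (φ*-≡⇒φ±∘ψ-≡ u v) (λ _ → trans Su (sym Sv)))
        fibreOfm (All-fibre (φ* A) (φ* A m) f) (InKer-fibre (φ* A) (φ* A m) f f∈ker))
    where fibreOfm = fibre (φ* A) (φ* A m) f

  IsInit-collapse : ∀ f m → IsInit _<rl_ f m → IsInit _<rl_ (collapse f m) (ψ m)
  IsInit-collapse f m init =
    IsInit-rename _<rl_ _<rl_ (λ u → φ* A u ≡ φ* A m)
      (λ {u} {v} Su Sv → ψ-injective-on-fibres u v (trans Su (sym Sv)))
      (λ {u} {v} Su Sv → ψ-monotone-on-fibres u v (trans Su (sym Sv)))
      _ (All-fibre (φ* A) (φ* A m) f) (IsInit-fibre _<rl_ (φ* A) f init)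

  isGröbnerBasis-transfer : ∀ G → InitialsFreeOfW K G →
    IsGröbnerBasis (InKer (φ± A)) _<rl_ (map (rename δ±) G) →
    IsGröbnerBasis (InKer (φ* A)) _<rl_ (map (rename δ*) G)
  isGröbnerBasis-transfer G freeOfW (inKer± , initials±) = inKer* , initials*
    where
    inKer* : ∀ g* → g* ∈ map (rename δ*) G → InKer (φ* A) g*
    inKer* _ g*∈ with ∈-map⁻ (rename δ*) g*∈
    ... | g , g∈G , refl = InKer-δ±⇒InKer-δ* g (inKer± _ (∈-map⁺ (rename δ±) g∈G))

    initials* : ∀ f m → InKer (φ* A) f → IsInit _<rl_ f m →
      ∃[ g* ] ∃[ m′ ] (g* ∈ map (rename δ*) G × IsInit _<rl_ g* m′ × (m′ ∣ₘ m))
    initials* f m@(a ∷ b ∷ w) f∈ker init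
      with initials± (collapse f m) (ψ m) (InKer-collapse f m f∈ker) (IsInit-collapse f m init)
    ... | _ , _ , g±∈ , init± , in±∣ψm with ∈-map⁻ (rename δ±) g±∈
    ... | g , g∈G , refl with IsInit-rename⁻ _<w_ _<rl_ δ±-injective (λ u<v → u<v) g init±
    ... | c ∷ x , refl , initW with freeOfW g∈G initW
    ... | refl = rename δ* g , 0 ∷ 0 ∷ x , ∈-map⁺ (rename δ*) g∈G , IsInit-δ* g initW , divides
      where
      divides : (0 ∷ 0 ∷ x) ∣ₘ m
      divides Fin.zero = ℕ.z≤n
      divides (Fin.suc Fin.zero) = ℕ.z≤n
      divides (Fin.suc (Fin.suc i)) = in±∣ψm (Fin.suc i)

  monic-transfer : ∀ g → ∃[ m ] (IsInit _<rl_ (rename δ± g) m × coeff (rename δ± g) m ≈ 1#) →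
    ∃[ m ] (IsInit _<rl_ (rename δ* g) m × coeff (rename δ* g) m ≈ 1#)
  monic-transfer g (_ , init± , monic±)
    with IsInit-rename⁻ _<w_ _<rl_ δ±-injective (λ u<v → u<v) g init±
  ... | m , refl , initW = δ* m , IsInit-δ* g initW , subst (_≈ 1#) same-coeff monic±
    where
    same-coeff : coeff (rename δ± g) (δ± m) ≡ coeff (rename δ* g) (δ* m)
    same-coeff = trans (coeff-rename-injective δ±-injective g) (sym (coeff-rename-injective δ*-injective g))

  NoInitialDivides : ∀ {N} → Poly N → Poly N → Set ℓ
  NoInitialDivides g′ g = ∀ m′ u → ¬ (g′ ≈ₚ g) → IsInit _<rl_ g′ m′ → ¬ (coeff g u ≈ 0#) → ¬ (m′ ∣ₘ u)

  NoInitialDivides-transfer : ∀ g′ g →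
    NoInitialDivides (rename δ± g′) (rename δ± g) → NoInitialDivides (rename δ* g′) (rename δ* g)
  NoInitialDivides-transfer g′ g noDivides± _ _ δ*g′≉δ*g init′ nzu in′∣u
    with IsInit-rename⁻ _<w_ _<rl_ δ*-injective (δ*-reflects-< _ _) g′ init′
       | ∈ₘ-rename⁻ δ* g (coeff≉0⇒∈ₘ _ nzu)
  ... | m , refl , initW | u , _ , refl =
    noDivides± (δ± m) (δ± u) δ±g′≉δ±g (IsInit-δ± g′ initW) nz± (δ*-∣ₘ⇒δ±-∣ₘ m u in′∣u)
    where
    δ±g′≉δ±g : ¬ (rename δ± g′ ≈ₚ rename δ± g)
    δ±g′≉δ±g = δ*g′≉δ*g ∘ rename-≈ₚ δ*-injective g′ g ∘ rename-≈ₚ⁻ δ±-injective g′ g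
    nz± : ¬ coeff (rename δ± g) (δ± u) ≈ 0#
    nz± = nzu ∘ subst (_≈ 0#)
      (trans (coeff-rename-injective δ±-injective g) (sym (coeff-rename-injective δ*-injective g)))

  isReducedGröbnerBasis-transfer : ∀ G → InitialsFreeOfW K G →
    IsReducedGröbnerBasis (InKer (φ± A)) _<rl_ (map (rename δ±) G) →
    IsReducedGröbnerBasis (InKer (φ* A)) _<rl_ (map (rename δ*) G)
  isReducedGröbnerBasis-transfer G freeOfW (gb± , reduced±) =
    isGröbnerBasis-transfer G freeOfW gb± , reduced*
    where
    reduced* : ∀ g* → g* ∈ map (rename δ*) G →
      (∃[ m ] (IsInit _<rl_ g* m × coeff g* m ≈ 1#)) ×
      (∀ g′* m′ u → g′* ∈ map (rename δ*) G → ¬ (g′* ≈ₚ g*) → IsInit _<rl_ g′* m′ →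
         ¬ (coeff g* u ≈ 0#) → ¬ (m′ ∣ₘ u))
    reduced* _ g*∈ with ∈-map⁻ (rename δ*) g*∈
    ... | g , g∈G , refl = monic-transfer g (proj₁ (reduced± _ δ±g∈)) , noDivides*
      where
      δ±g∈ = ∈-map⁺ (rename δ±) g∈G
      noDivides* : ∀ g′* m′ u → g′* ∈ map (rename δ*) G → ¬ (g′* ≈ₚ rename δ* g) →
        IsInit _<rl_ g′* m′ → ¬ (coeff (rename δ* g) u ≈ 0#) → ¬ (m′ ∣ₘ u)
      noDivides* _ m′ u g′*∈ with ∈-map⁻ (rename δ*) g′*∈
      ... | g′ , g′∈G , refl = NoInitialDivides-transfer g′ g
              (λ m′ u → proj₂ (reduced± _ δ±g∈) _ m′ u (∈-map⁺ (rename δ±) g′∈G)) m′ u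

deg-pairUp-zeroPairs : ∀ k → deg (pairUp (zeroPairs k)) ≡ 0
deg-pairUp-zeroPairs zero = refl
deg-pairUp-zeroPairs (suc k) = deg-pairUp-zeroPairs k

deg-pairUp-unitPair : ∀ {k} (i : Fin k) → deg (pairUp (unitPair i)) ≡ 2
deg-pairUp-unitPair {suc k} Fin.zero = cong (λ s → suc (suc s)) (deg-pairUp-zeroPairs k)
deg-pairUp-unitPair {suc k} (Fin.suc i) = deg-pairUp-unitPair i

module BinomialBasis {c ℓ : Level} (K : Field c ℓ) (n : ℕ) where
  open Field K using (_≈_; _+_; -_; 0#; 1#; 0≉1; +-identityʳ)
    renaming (sym to ≈-sym; trans to ≈-trans)
  open WithField K
  open Polynomials K

  xᵢyᵢ : Fin n → Mon (double n)
  xᵢyᵢ i = pairUp (unitPair i)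

  one : Mon (double n)
  one = pairUp (zeroPairs n)

  binW : Fin n → Poly (suc (double n))
  binW i = (1# , 0 ∷ xᵢyᵢ i) ∷ (- 1# , 1 ∷ one) ∷ []

  embW : Poly (double n) → Poly (suc (double n))
  embW = rename (0 ∷_)

  basisW : List (Poly (double n)) → List (Poly (suc (double n)))
  basisW gs = map binW (allFin n) ++ map embW gs

  map-rename-basisW : ∀ {N} (h : Mon (suc (double n)) → Mon N)
    {bin : Fin n → Poly N} {emb : Poly (double n) → Poly N} →
    (∀ i → bin i ≡ rename h (binW i)) → (∀ g → emb g ≡ rename h (embW g)) →
    ∀ gs → map bin (allFin n) ++ map emb gs ≡ map (rename h) (basisW gs)
  map-rename-basisW h bin≡ emb≡ gs = begin
    map _ (allFin n) ++ map _ gs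
      ≡⟨ cong₂ _++_ (trans (List.map-cong bin≡ (allFin n)) (List.map-∘ (allFin n)))
                         (trans (List.map-cong emb≡ gs) (List.map-∘ gs)) ⟩
    map (rename h) (map binW (allFin n)) ++ map (rename h) (map embW gs)
      ≡⟨ List.map-++ (rename h) (map binW (allFin n)) (map embW gs) ⟨
    map (rename h) (basisW gs) ∎
    where open ≡-Reasoning

  basis±≡ : ∀ gs → map bin± (allFin n) ++ map emb± gs ≡ map (rename δ±) (basisW gs)
  basis±≡ = map-rename-basisW δ± (λ _ → refl) List.map-∘

  basis*≡ : ∀ gs → map bin* (allFin n) ++ map emb* gs ≡ map (rename δ*) (basisW gs)
  basis*≡ = map-rename-basisW δ* (λ _ → refl) List.map-∘

  1+0≉0 : ¬ (1# + 0#) ≈ 0#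
  1+0≉0 1+0≈0 = 0≉1 (≈-sym (≈-trans (≈-sym (+-identityʳ 1#)) 1+0≈0))

  w<xᵢyᵢ : ∀ i → (1 ∷ one) <w (0 ∷ xᵢyᵢ i)
  w<xᵢyᵢ i = inj₂ (trans (cong (2 ℕ.+_) (deg-pairUp-zeroPairs n)) (sym (deg-pairUp-unitPair i)) , inj₁ (ℕ.s≤s ℕ.z≤n))

  binW-initialFreeOfW : ∀ i {c x} → IsInit _<w_ (binW i) (c ∷ x) → c ≡ 0
  binW-initialFreeOfW i (nz , max) with coeff≉0⇒∈ₘ (binW i) nz
  ... | here eq = sym (∷-injectiveˡ eq)
  ... | there (here refl) with max (0 ∷ xᵢyᵢ i) (1+0≉0 ∘ subst (_≈ 0#) xᵢyᵢ-coeff)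
    where
    xᵢyᵢ-coeff : coeff (binW i) (0 ∷ xᵢyᵢ i) ≡ 1# + 0#
    xᵢyᵢ-coeff = trans (coeff-head 1# (0 ∷ xᵢyᵢ i) ((- 1# , 1 ∷ one) ∷ []))
                       (cong (1# +_) (coeff-miss ((- 1# , 1 ∷ one) ∷ []) {0 ∷ xᵢyᵢ i} ((λ ()) ∷ [])))
  ...   | inj₂ xᵢyᵢ<w = ⊥-elim (<rl-asym _ _ (w<xᵢyᵢ i) xᵢyᵢ<w)

  embW-initialFreeOfW : ∀ g {c x} → IsInit _<w_ (embW g) (c ∷ x) → c ≡ 0
  embW-initialFreeOfW g (nz , _) with ∈ₘ-rename⁻ (0 ∷_) g (coeff≉0⇒∈ₘ _ nz)
  ... | _ , _ , 0∷u≡c∷x = sym (∷-injectiveˡ 0∷u≡c∷x)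

  basisW-initialsFreeOfW : ∀ gs → InitialsFreeOfW K (basisW gs)
  basisW-initialsFreeOfW gs g∈ with ∈-++⁻ (map binW (allFin n)) g∈
  ... | inj₁ g∈bins with ∈-map⁻ binW g∈bins
  ...   | i , _ , refl = binW-initialFreeOfW i
  basisW-initialsFreeOfW gs g∈ | inj₂ g∈embs with ∈-map⁻ embW g∈embs
  ...   | g , _ , refl = embW-initialFreeOfW g

-- Unimodularity, distinct columns and the lattice-point condition are what give the basis of
-- I_{A±} its assumed shape; the transfer only uses that A is a configuration.
theorem1p4 : ∀ {c ℓ : Level} (K : Field c ℓ) (d n : ℕ) (A : Matrix d n) →
    IsConfiguration A → Unimodular A → NoRepeatedColumns A →
    LatticePointsA₀ A →
    (gs : List (WithField.Poly K (double n))) →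
    WithField.IsReducedGröbnerBasis K (WithField.InKer K (φ± A)) _<rl_
      (map (WithField.bin± K) (allFin n) ++ map (WithField.emb± K) gs) →
    WithField.IsReducedGröbnerBasis K (WithField.InKer K (φ* A)) _<rl_
      (map (WithField.bin* K) (allFin n) ++ map (WithField.emb* K) gs)
theorem1p4 K d n A conf _ _ _ gs isReduced± =
  subst (IsReducedGröbnerBasis (InKer (φ* A)) _<rl_) (sym (basis*≡ gs))
    (isReducedGröbnerBasis-transfer (basisW gs) (basisW-initialsFreeOfW gs)
      (subst (IsReducedGröbnerBasis (InKer (φ± A)) _<rl_) (basis±≡ gs) isReduced±))
  where
  open WithField K
  open BinomialBasis K n
  open GröbnerTransfer K A conf
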